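{- Let $n\ge 2$ be an integer and let $k$ be an integer with $2n-2\le k\le \frac{n^2-n+2}{2}$. Then there is a set $S_k$ of $n$ distinct real numbers with $a_{S_k}(n,1)=k$.
   Context: For a finite set $S\subset\mathbb{R}$ of $n$ points, $a_S(n,1)$ is the number of distinct orderings of $S$ induced by distance $|V-P|$ from a vantage point $V\in\mathbb{R}$, where $P_i$ precedes $P_j$ iff $|V-P_i|<|V-P_j|$; vantage points equidistant from two points of $S$ are ignored. Equivalently, $a_S(n,1)$ is one more than the number of distinct midpoints $\frac{P_i+P_j}{2}$, $i\ne j$. -}

module Defs where

open import Data.Nat using (ℕ; suc)
open import Data.Rational using (ℚ; _+_; _*_; ½)
open import Data.Rational.Properties using (_≟_)
open import Data.List using (List; []; _∷_; map; _++_; length; deduplicate)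

midpoint : ℚ → ℚ → ℚ
midpoint p q = (p + q) * ½

midpoints : List ℚ → List ℚ
midpoints [] = []
midpoints (x ∷ xs) = map (midpoint x) xs ++ midpoints xs

a-S : List ℚ → ℕ
a-S S = suc (length (deduplicate _≟_ (midpoints S)))

{-# OPTIONS --safe #-}

-- For integer points the midpoint of P and Q is (P + Q)/2, so a_S(n,1) is one more than the
-- number of distinct pairwise sums of S; it suffices to find n distinct naturals with exactly
-- m distinct pairwise sums for every 2n - 3 ≤ m ≤ n(n - 1)/2.
-- For S = {0, …, n - 2} ∪ {x} with n - 1 ≤ x ≤ 2n - 4 the sums fill the interval [1, x + n - 2],
-- which gives every m in [2n - 3, 3n - 6]. Adding to any S a point beyond twice its maximum
-- creates |S| new sums, distinct and larger than all old ones; applied to n - 1 points this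
-- reaches, by induction, every m in [3n - 6, n(n - 1)/2].

module Submission where

open import Defs
open import Data.Nat using (ℕ; zero; suc; _≤_; _*_; _+_; _∸_; z≤n; s≤s)
open import Data.Nat.Properties
open import Data.Nat.Tactic.RingSolver using (solve-∀)
import Data.Integer as ℤ
import Data.Integer.Properties as ℤ
import Data.Integer.Tactic.RingSolver as ℤSolver
open import Data.Rational as ℚ using (ℚ; ½; toℚᵘ; fromℚᵘ)
open import Data.Rational.Properties
  using (toℚᵘ-injective; toℚᵘ-homo-+; toℚᵘ-homo-*; toℚᵘ-fromℚᵘ; fromℚᵘ-injective)
open import Data.Rational.Unnormalised as ℚᵘ using (mkℚᵘ; *≡*)
import Data.Rational.Unnormalised.Properties as ℚᵘ
open import Data.List using (List; []; _∷_; length; map; _++_; deduplicate; applyUpTo; downFrom)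
open import Data.List.Properties
  using (length-map; length-++; map-++; map-∘; map-cong; length-applyUpTo; length-downFrom)
open import Data.List.Extrema.Nat using (max; xs≤max)
open import Data.List.Membership.Propositional using (_∈_)
open import Data.List.Membership.Propositional.Properties
  using ( ∈-map⁺; ∈-map⁻; ∈-++⁺ˡ; ∈-++⁺ʳ; ∈-++⁻; deduplicate-∈⇔
        ; ∈-applyUpTo⁺; ∈-applyUpTo⁻; ∈-downFrom⁺; ∈-downFrom⁻)
open import Data.List.Membership.Propositional.Properties.WithK using (unique∧set⇒bag)
open import Data.List.Relation.Unary.Any using (here; there)
import Data.List.Relation.Unary.All as All
open import Data.List.Relation.Unary.AllPairs using (_∷_)
open import Data.List.Relation.Unary.Unique.Propositional using (Unique)
import Data.List.Relation.Unary.Unique.Propositional.Properties as Unique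
open import Data.List.Relation.Unary.Unique.DecPropositional.Properties using (deduplicate-!)
open import Data.List.Relation.Binary.Disjoint.Propositional using (Disjoint)
open import Data.List.Relation.Binary.BagAndSetEquality using (_∼[_]_; set; ∼bag⇒↭)
import Data.List.Relation.Binary.BagAndSetEquality as BagAndSet
open import Data.List.Relation.Binary.Permutation.Propositional.Properties using (↭-length)
open import Data.List.Relation.Binary.Permutation.Propositional.Properties.WithK using (dedup-++-↭)
open import Data.Product using (Σ; ∃₂; _×_; _,_)
open import Data.Sum using (inj₁; inj₂)
open import Function using (_⇔_; mk⇔; Equivalence)
import Function.Properties.Equivalence as ⇔
open import Relation.Binary.Definitions using (DecidableEquality)
open import Relation.Binary.PropositionalEquality
  using (_≡_; _≢_; refl; sym; trans; cong; cong₂; subst; subst₂; module ≡-Reasoning)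
open import Relation.Nullary using (yes; no)

open Equivalence using (to; from)

distinct : {A : Set} → DecidableEquality A → List A → ℕ
distinct _≟_ xs = length (deduplicate _≟_ xs)

unique∧set⇒length≡ : {A : Set} {xs ys : List A} →
                      Unique xs → Unique ys → xs ∼[ set ] ys → length xs ≡ length ys
unique∧set⇒length≡ uxs uys xs∼ys = ↭-length (∼bag⇒↭ (unique∧set⇒bag uxs uys xs∼ys))

module _ {A : Set} (_≟_ : DecidableEquality A) where

  distinct-cong : {xs ys : List A} → xs ∼[ set ] ys → distinct _≟_ xs ≡ distinct _≟_ ys
  distinct-cong xs∼ys = unique∧set⇒length≡ (deduplicate-! _≟_ _) (deduplicate-! _≟_ _)
    (⇔.trans (⇔.sym (deduplicate-∈⇔ _≟_)) (⇔.trans xs∼ys (deduplicate-∈⇔ _≟_)))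

  distinct-unique : {xs : List A} → Unique xs → distinct _≟_ xs ≡ length xs
  distinct-unique uxs = unique∧set⇒length≡ (deduplicate-! _≟_ _) uxs (⇔.sym (deduplicate-∈⇔ _≟_))

  distinct-++ : {xs ys : List A} → Disjoint xs ys →
                distinct _≟_ (xs ++ ys) ≡ distinct _≟_ xs + distinct _≟_ ys
  distinct-++ {xs} disj = trans (↭-length (dedup-++-↭ _≟_ disj)) (length-++ (deduplicate _≟_ xs))

distinct-map : {A B : Set} (_≟ᴬ_ : DecidableEquality A) (_≟ᴮ_ : DecidableEquality B) {f : A → B} →
               (∀ {x y} → f x ≡ f y → x ≡ y) → (xs : List A) →
               distinct _≟ᴮ_ (map f xs) ≡ distinct _≟ᴬ_ xs
distinct-map _≟ᴬ_ _≟ᴮ_ {f} f-injective xs = trans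
  (unique∧set⇒length≡ (deduplicate-! _≟ᴮ_ _) (Unique.map⁺ f-injective (deduplicate-! _≟ᴬ_ xs))
    (⇔.trans (⇔.sym (deduplicate-∈⇔ _≟ᴮ_)) (BagAndSet.map-cong (λ _ → refl) (deduplicate-∈⇔ _≟ᴬ_))))
  (length-map f (deduplicate _≟ᴬ_ xs))

fromℕ : ℕ → ℚ
fromℕ n = fromℚᵘ (mkℚᵘ (ℤ.+ n) 0)

half : ℕ → ℚ
half n = fromℚᵘ (mkℚᵘ (ℤ.+ n) 1)

fromℚᵘ-mkℚᵘ-injective : ∀ d {a b} → fromℚᵘ (mkℚᵘ (ℤ.+ a) d) ≡ fromℚᵘ (mkℚᵘ (ℤ.+ b) d) → a ≡ b
fromℚᵘ-mkℚᵘ-injective d {a} {b} eq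
  with *≡* a*d≡b*d ← fromℚᵘ-injective {mkℚᵘ (ℤ.+ a) d} {mkℚᵘ (ℤ.+ b) d} eq =
  ℤ.+-injective (ℤ.*-cancelʳ-≡ (ℤ.+ a) (ℤ.+ b) (ℤ.+ suc d) a*d≡b*d)

fromℕ-injective : ∀ {a b} → fromℕ a ≡ fromℕ b → a ≡ b
fromℕ-injective = fromℚᵘ-mkℚᵘ-injective 0

half-injective : ∀ {a b} → half a ≡ half b → a ≡ b
half-injective = fromℚᵘ-mkℚᵘ-injective 1

mkℚᵘ-midpoint : ∀ (x y : ℤ.ℤ) →
                (mkℚᵘ x 0 ℚᵘ.+ mkℚᵘ y 0) ℚᵘ.* mkℚᵘ (ℤ.+ 1) 1 ℚᵘ.≃ mkℚᵘ (x ℤ.+ y) 1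
mkℚᵘ-midpoint x y = *≡* (cross-multiplied x y)
  where
  cross-multiplied : ∀ x y → ((x ℤ.* ℤ.+ 1 ℤ.+ y ℤ.* ℤ.+ 1) ℤ.* ℤ.+ 1) ℤ.* ℤ.+ 2 ≡ (x ℤ.+ y) ℤ.* ℤ.+ 2
  cross-multiplied = ℤSolver.solve-∀

midpoint-fromℕ : ∀ a b → midpoint (fromℕ a) (fromℕ b) ≡ half (a + b)
midpoint-fromℕ a b = toℚᵘ-injective (begin
  toℚᵘ (midpoint (fromℕ a) (fromℕ b))
    ≈⟨ toℚᵘ-homo-* (fromℕ a ℚ.+ fromℕ b) ½ ⟩
  toℚᵘ (fromℕ a ℚ.+ fromℕ b) ℚᵘ.* toℚᵘ ½
    ≈⟨ ℚᵘ.*-congʳ (toℚᵘ-homo-+ (fromℕ a) (fromℕ b)) ⟩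
  (toℚᵘ (fromℕ a) ℚᵘ.+ toℚᵘ (fromℕ b)) ℚᵘ.* toℚᵘ ½
    ≈⟨ ℚᵘ.*-congʳ (ℚᵘ.+-cong (toℚᵘ-fromℚᵘ (mkℚᵘ (ℤ.+ a) 0)) (toℚᵘ-fromℚᵘ (mkℚᵘ (ℤ.+ b) 0))) ⟩
  (mkℚᵘ (ℤ.+ a) 0 ℚᵘ.+ mkℚᵘ (ℤ.+ b) 0) ℚᵘ.* mkℚᵘ (ℤ.+ 1) 1
    ≈⟨ mkℚᵘ-midpoint (ℤ.+ a) (ℤ.+ b) ⟩
  mkℚᵘ (ℤ.+ (a + b)) 1
    ≈⟨ toℚᵘ-fromℚᵘ (mkℚᵘ (ℤ.+ (a + b)) 1) ⟨
  toℚᵘ (half (a + b)) ∎)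
  where open ℚᵘ.≃-Reasoning

pairSums : List ℕ → List ℕ
pairSums []       = []
pairSums (x ∷ xs) = map (x +_) xs ++ pairSums xs

midpoints-map : {f g : ℕ → ℚ} → (∀ a b → midpoint (f a) (f b) ≡ g (a + b)) →
                ∀ xs → midpoints (map f xs) ≡ map g (pairSums xs)
midpoints-map         f-mid []       = refl
midpoints-map {f} {g} f-mid (x ∷ xs) = begin
  map (midpoint (f x)) (map f xs) ++ midpoints (map f xs)  ≡⟨ cong₂ _++_ first-row (midpoints-map f-mid xs) ⟩
  map g (map (x +_) xs) ++ map g (pairSums xs)             ≡⟨ map-++ g (map (x +_) xs) (pairSums xs) ⟨
  map g (map (x +_) xs ++ pairSums xs)                     ∎
  where
  open ≡-Reasoning
  first-row : map (midpoint (f x)) (map f xs) ≡ map g (map (x +_) xs)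
  first-row = trans (sym (map-∘ xs)) (trans (map-cong (f-mid x) xs) (map-∘ xs))

a-S-map-fromℕ : ∀ xs → a-S (map fromℕ xs) ≡ suc (distinct _≟_ (pairSums xs))
a-S-map-fromℕ xs = cong suc (begin
  distinct ℚ._≟_ (midpoints (map fromℕ xs))  ≡⟨ cong (distinct ℚ._≟_) (midpoints-map midpoint-fromℕ xs) ⟩
  distinct ℚ._≟_ (map half (pairSums xs))    ≡⟨ distinct-map _≟_ ℚ._≟_ half-injective (pairSums xs) ⟩
  distinct _≟_ (pairSums xs)                 ∎)
  where open ≡-Reasoning

∈-pairSums⁻ : ∀ xs {z} → z ∈ pairSums xs → ∃₂ λ a b → a ∈ xs × b ∈ xs × z ≡ a + b
∈-pairSums⁻ (x ∷ xs) z∈ with ∈-++⁻ (map (x +_) xs) z∈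
... | inj₁ z∈row with y , y∈ , refl ← ∈-map⁻ (x +_) z∈row = x , y , here refl , there y∈ , refl
... | inj₂ z∈rest with a , b , a∈ , b∈ , refl ← ∈-pairSums⁻ xs z∈rest = a , b , there a∈ , there b∈ , refl

∈-applyUpTo-suc : ∀ m {z} → z ∈ applyUpTo suc m ⇔ (1 ≤ z × z ≤ m)
∈-applyUpTo-suc m = mk⇔ to′ from′
  where
  to′ : ∀ {z} → z ∈ applyUpTo suc m → 1 ≤ z × z ≤ m
  to′ z∈ with i , i<m , refl ← ∈-applyUpTo⁻ suc z∈ = s≤s z≤n , i<m
  from′ : ∀ {z} → 1 ≤ z × z ≤ m → z ∈ applyUpTo suc m
  from′ {suc z} (_ , z<m) = ∈-applyUpTo⁺ suc z<m

∈-map-+-downFrom : ∀ x k {z} → z ∈ map (x +_) (downFrom (suc k)) ⇔ (x ≤ z × z ≤ x + k)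
∈-map-+-downFrom x k = mk⇔ to′ from′
  where
  to′ : ∀ {z} → z ∈ map (x +_) (downFrom (suc k)) → x ≤ z × z ≤ x + k
  to′ z∈ with y , y∈ , refl ← ∈-map⁻ (x +_) z∈ = m≤m+n x y , +-monoʳ-≤ x (≤-pred (∈-downFrom⁻ y∈))
  from′ : ∀ {z} → x ≤ z × z ≤ x + k → z ∈ map (x +_) (downFrom (suc k))
  from′ (x≤z , z≤x+k) with d , refl ← m≤n⇒∃[o]m+o≡n x≤z =
    ∈-map⁺ (x +_) (∈-downFrom⁺ (s≤s (+-cancelˡ-≤ x _ _ z≤x+k)))

∈-pairSums-∷-downFrom : ∀ {x k b} → (∀ {z} → z ∈ pairSums (downFrom (suc k)) ⇔ (1 ≤ z × z ≤ b)) →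
                        1 ≤ x → x ≤ suc b → b ≤ x + k →
                        ∀ {z} → z ∈ pairSums (x ∷ downFrom (suc k)) ⇔ (1 ≤ z × z ≤ x + k)
∈-pairSums-∷-downFrom {x} {k} {b} old 1≤x x≤1+b b≤x+k {z} = mk⇔ to′ from′
  where
  row = ∈-map-+-downFrom x k
  to′ : z ∈ pairSums (x ∷ downFrom (suc k)) → 1 ≤ z × z ≤ x + k
  to′ z∈ with ∈-++⁻ (map (x +_) (downFrom (suc k))) z∈
  ... | inj₁ z∈row with x≤z , z≤x+k ← to row z∈row = ≤-trans 1≤x x≤z , z≤x+k
  ... | inj₂ z∈old with 1≤z , z≤b ← to old z∈old = 1≤z , ≤-trans z≤b b≤x+k
  from′ : 1 ≤ z × z ≤ x + k → z ∈ pairSums (x ∷ downFrom (suc k))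
  from′ (1≤z , z≤x+k) with z ≤? b
  ... | yes z≤b = ∈-++⁺ʳ (map (x +_) (downFrom (suc k))) (from old (1≤z , z≤b))
  ... | no z≰b  = ∈-++⁺ˡ (from row (≤-trans x≤1+b (≰⇒> z≰b) , z≤x+k))

∈-pairSums-downFrom : ∀ i {z} → z ∈ pairSums (downFrom (2 + i)) ⇔ (1 ≤ z × z ≤ suc (i + i))
∈-pairSums-downFrom zero = ∈-pairSums-∷-downFrom no-sums ≤-refl ≤-refl z≤n
  where
  no-sums : ∀ {z} → z ∈ [] ⇔ (1 ≤ z × z ≤ 0)
  no-sums = mk⇔ (λ ()) (λ { (s≤s _ , ()) })
∈-pairSums-downFrom (suc i) = ∈-pairSums-∷-downFrom (∈-pairSums-downFrom i)
  (s≤s z≤n) (s≤s (s≤s (m≤m+n i i))) (s≤s (≤-trans (+-monoʳ-≤ i (n≤1+n i)) (n≤1+n _)))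

Realisable : ℕ → ℕ → Set
Realisable n m = Σ (List ℕ) λ S → length S ≡ n × Unique S × distinct _≟_ (pairSums S) ≡ m

realisable-base : ∀ i x → 2 + i ≤ x → x ≤ 2 + (i + i) → Realisable (3 + i) (x + suc i)
realisable-base i x 2+i≤x x≤2+2i =
  x ∷ downFrom (2 + i) , cong suc (length-downFrom (2 + i)) , x-fresh ∷ Unique.downFrom⁺ (2 + i) , count
  where
  x-fresh : All.All (x ≢_) (downFrom (2 + i))
  x-fresh = All.tabulate (λ y∈ → >⇒≢ (<-≤-trans (∈-downFrom⁻ y∈) 2+i≤x))
  1+2i≤x+i : suc (i + i) ≤ x + suc i
  1+2i≤x+i = ≤-trans (s≤s (≤-trans (+-monoʳ-≤ i (n≤1+n i)) (n≤1+n _))) (+-monoˡ-≤ (suc i) 2+i≤x)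
  sums∼interval : pairSums (x ∷ downFrom (2 + i)) ∼[ set ] applyUpTo suc (x + suc i)
  sums∼interval = ⇔.trans
    (∈-pairSums-∷-downFrom (∈-pairSums-downFrom i) (≤-trans (s≤s z≤n) 2+i≤x) x≤2+2i 1+2i≤x+i)
    (⇔.sym (∈-applyUpTo-suc (x + suc i)))
  interval-unique : Unique (applyUpTo suc (x + suc i))
  interval-unique = Unique.applyUpTo⁺₁ suc (x + suc i) (λ i<j _ → <⇒≢ (s≤s i<j))
  count : distinct _≟_ (pairSums (x ∷ downFrom (2 + i))) ≡ x + suc i
  count = begin
    distinct _≟_ (pairSums (x ∷ downFrom (2 + i)))  ≡⟨ distinct-cong _≟_ sums∼interval ⟩
    distinct _≟_ (applyUpTo suc (x + suc i))         ≡⟨ distinct-unique _≟_ interval-unique ⟩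
    length (applyUpTo suc (x + suc i))               ≡⟨ length-applyUpTo suc (x + suc i) ⟩
    x + suc i                                        ∎
    where open ≡-Reasoning

beyond : List ℕ → ℕ
beyond xs = suc (max 0 xs + max 0 xs)

beyond-fresh : ∀ xs → All.All (beyond xs ≢_) xs
beyond-fresh xs = All.map (λ y≤max → >⇒≢ (s≤s (≤-trans y≤max (m≤m+n _ _)))) (xs≤max 0 xs)

pairSums-≤ : ∀ xs {z} → z ∈ pairSums xs → z ≤ max 0 xs + max 0 xs
pairSums-≤ xs z∈ with a , b , a∈ , b∈ , refl ← ∈-pairSums⁻ xs z∈ =
  +-mono-≤ (All.lookup (xs≤max 0 xs) a∈) (All.lookup (xs≤max 0 xs) b∈)

distinct-pairSums-beyond : ∀ {xs} → Unique xs →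
  distinct _≟_ (pairSums (beyond xs ∷ xs)) ≡ length xs + distinct _≟_ (pairSums xs)
distinct-pairSums-beyond {xs} uxs =
  trans (distinct-++ _≟_ disjoint) (cong (_+ distinct _≟_ (pairSums xs)) row-count)
  where
  x = beyond xs
  disjoint : Disjoint (map (x +_) xs) (pairSums xs)
  disjoint (v∈row , v∈sums) with y , _ , refl ← ∈-map⁻ (x +_) v∈row =
    <⇒≱ (m≤m+n x y) (pairSums-≤ xs v∈sums)
  row-count : distinct _≟_ (map (x +_) xs) ≡ length xs
  row-count = trans (distinct-unique _≟_ (Unique.map⁺ (+-cancelˡ-≡ x _ _) uxs)) (length-map (x +_) xs)

realisable-beyond : ∀ {n m} → Realisable n m → Realisable (suc n) (n + m)
realisable-beyond (S , refl , uS , refl) =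
  beyond S ∷ S , refl , beyond-fresh S ∷ uS , distinct-pairSums-beyond uS

-- i + 2 points and 2 (i + 2) - 3 + e sums, where e ≤ C(i, 2) is the excess over the minimum.
realisable : ∀ i e → 2 * e + i ≤ i * i → Realisable (2 + i) (1 + 2 * i + e)
realisable zero    zero    _ = downFrom 2 , refl , Unique.downFrom⁺ 2 , refl
realisable zero    (suc e) ()
realisable (suc j) e excess≤ with e ≤? j
... | yes e≤j = subst (Realisable (3 + j)) (base-count j e)
  (realisable-base j (2 + j + e) (m≤m+n (2 + j) e) (s≤s (s≤s (+-monoʳ-≤ j e≤j))))
  where
  base-count : ∀ j e → 2 + j + e + suc j ≡ 1 + 2 * suc j + e
  base-count = solve-∀
... | no e≰j with e′ , refl ← m≤n⇒∃[o]m+o≡n (≰⇒≥ e≰j) =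
  subst (Realisable (3 + j)) (beyond-count j e′) (realisable-beyond (realisable j e′ excess′≤))
  where
  beyond-count : ∀ j e′ → 2 + j + (1 + 2 * j + e′) ≡ 1 + 2 * suc j + (j + e′)
  beyond-count = solve-∀
  lhs : ∀ j e′ → 2 * (j + e′) + suc j ≡ 2 * e′ + j + suc (j + j)
  lhs = solve-∀
  rhs : ∀ j → suc j * suc j ≡ j * j + suc (j + j)
  rhs = solve-∀
  excess′≤ : 2 * e′ + j ≤ j * j
  excess′≤ = +-cancelʳ-≤ (suc (j + j)) _ _ (subst₂ _≤_ (lhs j e′) (rhs j) excess≤)

2*[2+n]∸2 : ∀ n → 2 * (2 + n) ∸ 2 ≡ 2 + 2 * n
2*[2+n]∸2 n = reduced n
  where
  -- the normal form of the left-hand side, which the solver cannot read through _∸_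
  reduced : ∀ n → n + (2 + (n + 0)) ≡ 2 + 2 * n
  reduced = solve-∀

upper⇒excess-bound : ∀ i e → 2 * (2 + 2 * i + e) ≤ (2 + i) * (2 + i) ∸ (2 + i) + 2 → 2 * e + i ≤ i * i
upper⇒excess-bound i e upper = +-cancelʳ-≤ (3 * i + 4) _ _ (subst₂ _≤_ (lhs i e) rhs upper)
  where
  lhs : ∀ i e → 2 * (2 + 2 * i + e) ≡ 2 * e + i + (3 * i + 4)
  lhs = solve-∀
  expand : ∀ i → suc i * (2 + i) + 2 ≡ i * i + (3 * i + 4)
  expand = solve-∀
  rhs : (2 + i) * (2 + i) ∸ (2 + i) + 2 ≡ i * i + (3 * i + 4)
  rhs = trans (cong (_+ 2) (m+n∸m≡n (2 + i) (suc i * (2 + i)))) (expand i)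

theorem3p1 : (n k : ℕ) → 2 ≤ n → 2 * n ∸ 2 ≤ k → 2 * k ≤ n * n ∸ n + 2 →
    Σ (List ℚ) (λ S → length S ≡ n × Unique S × a-S S ≡ k)
theorem3p1 (suc (suc i)) k (s≤s (s≤s z≤n)) lower upper
  with e , refl ← m≤n⇒∃[o]m+o≡n (subst (_≤ k) (2*[2+n]∸2 i) lower)
  with S , |S|≡n , uniqueS , count ← realisable i e (upper⇒excess-bound i e upper)
  = map fromℕ S , trans (length-map fromℕ S) |S|≡n , Unique.map⁺ fromℕ-injective uniqueS ,
    trans (a-S-map-fromℕ S) (cong suc count)
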